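{- Let $u=u_0\dots u_{k-1}$ be a word over $\Sigma$ with $u_0=0$ and $k\ge2$, and let $0\le i<k$. Then $\mathrm{K}(u)(nk+i)=\mathrm{K}(u)(n)+u_i$ for all $n\ge0$, and hence $\mathrm{K}(u)_{i,k}\sim\mathrm{K}(u)$. Consequently $(i,k^n)\in\mathrm{AS}(\mathrm{K}(u))$ for all $n\ge0$ and $0\le i<k^n$.
   Context: $\Sigma$ is a finite cyclic (additive) group. Keane product: $u\times\varepsilon=\varepsilon$, $u\times(av)=(u+a)(u\times v)$, with $u+a$ adding $a$ to each letter; $u^{\times0}=0$, $u^{\times(n+1)}=u\times u^{\times n}$; $\mathrm{K}(u)=\lim_nu^{\times n}$, indexed from $0$. For $\sigma$ indexed from $0$, $\sigma_{a,b}(n)=\sigma(a+bn)$ ($a\ge0$, $b\ge1$). $\sigma\sim\tau$ means $\sigma=\tau+c$ pointwise for some constant $c\in\Sigma$. $\mathrm{AS}(\sigma)=\{(a,b): a\ge0,\ b\ge1,\ \sigma_{a,b}\sim\sigma\}$. -}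

module Defs where

open import Data.Nat using (ℕ; zero; suc; _+_; _*_; _≤_; _<_)
open import Data.Nat.DivMod using (_mod_)
open import Data.Fin using (Fin; toℕ)
open import Data.List using (List; []; _∷_; map; _++_)
open import Data.Maybe using (Maybe; just; nothing)
open import Data.Product using (Σ; ∃; _×_)
open import Relation.Binary.PropositionalEquality using (_≡_)

-- The finite cyclic group Σ is modelled as ℤ/(suc m) = Fin (suc m)
-- with addition modulo (suc m).
Sym : ℕ → Set
Sym m = Fin (suc m)

_⊕_ : ∀ {m} → Sym m → Sym m → Sym m
_⊕_ {m} a b = (toℕ a + toℕ b) mod (suc m)

𝟎 : ∀ {m} → Sym m
𝟎 = Fin.zero

Word : ℕ → Set
Word m = List (Sym m)

shift : ∀ {m} → Word m → Sym m → Word m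
shift u a = map (_⊕ a) u

_⊠_ : ∀ {m} → Word m → Word m → Word m
u ⊠ [] = []
u ⊠ (a ∷ v) = shift u a ++ (u ⊠ v)

kpow : ∀ {m} → Word m → ℕ → Word m
kpow u zero = 𝟎 ∷ []
kpow u (suc n) = u ⊠ kpow u n

_!_ : ∀ {m} → Word m → ℕ → Maybe (Sym m)
[] ! j = nothing
(a ∷ w) ! zero = just a
(a ∷ w) ! suc j = w ! j

-- σ is the limit K(u) = lim_n u^{×n} (discrete topology on Σ^ℕ):
-- each letter of σ eventually appears, at the same position, in all u^{×n}.
IsKeaneLimit : ∀ {m} → Word m → (ℕ → Sym m) → Set
IsKeaneLimit u σ = ∀ j → ∃ λ N → ∀ n → N ≤ n → kpow u n ! j ≡ just (σ j)

subseq : ∀ {m} → (ℕ → Sym m) → ℕ → ℕ → (ℕ → Sym m)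
subseq σ a b n = σ (a + b * n)

_∼_ : ∀ {m} → (ℕ → Sym m) → (ℕ → Sym m) → Set
_∼_ {m} σ τ = Σ (Sym m) λ c → ∀ n → σ n ≡ τ n ⊕ c

-- (a , b) ∈ AS(σ)   (a ≥ 0 automatic for a : ℕ)
InAS : ∀ {m} → (ℕ → Sym m) → ℕ → ℕ → Set
InAS σ a b = 1 ≤ b × (subseq σ a b ∼ σ)

module Submission where

-- The letter at position j·k + i of a Keane product u × v is u_i + v_j:
-- the j-th block of u × v is the shifted copy u + v_j.  Since
-- K(u) = lim u^{×n} and u^{×(n+1)} = u × u^{×n}, passing to the limit gives
-- the recursion  σ(j·k + i) = σ(j) + u_i,  i.e. σ is "k-self-similar with
-- digit offsets u_i".  Everything else only uses this recursion:
--   * reading it along j gives σ_{i,k} ∼ σ with constant u_i;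
--   * induction on n, splitting i < k^(n+1) as i = r + q·k with r < k and
--     q < k^n, gives σ_{i,k^n} ∼ σ, i.e. (i, k^n) ∈ AS(σ).

open import Defs
open import Data.Nat using (ℕ; zero; suc; _+_; _*_; _^_; _≤_; _<_; s≤s; z≤n; NonZero; >-nonZero; _%_)
open import Data.Nat.Properties using (+-comm; +-assoc; *-comm; +-identityʳ; ≤-trans; m≤m+n; m≤n+m; n≤1+n; m^n>0)
open import Data.Nat.DivMod using (_mod_; _divMod_; DivMod; m<n⇒m%n≡m; %-distribˡ-+; m%n%n≡m%n; m<n*o⇒m/o<n)
open import Data.Nat.Solver using (module +-*-Solver)
open import Data.Fin using (Fin; toℕ)
open import Data.Fin.Properties using (toℕ-fromℕ<; toℕ-injective; toℕ<n)
open import Data.List using ([]; _∷_; length; head; lookup; _++_)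
open import Data.Maybe using (just)
open import Data.Maybe.Properties using (just-injective)
open import Data.Product using (_×_; _,_)
open import Relation.Binary.PropositionalEquality using (_≡_; refl; sym; trans; cong; subst; module ≡-Reasoning)

toℕ-⊕ : ∀ {m} (a b : Sym m) → toℕ (a ⊕ b) ≡ (toℕ a + toℕ b) % suc m
toℕ-⊕ a b = toℕ-fromℕ< _

⊕-comm : ∀ {m} (a b : Sym m) → a ⊕ b ≡ b ⊕ a
⊕-comm {m} a b = cong (_mod suc m) (+-comm (toℕ a) (toℕ b))

⊕-identityʳ : ∀ {m} (a : Sym m) → a ⊕ 𝟎 ≡ a
⊕-identityʳ {m} a = toℕ-injective (begin
  toℕ (a ⊕ 𝟎)         ≡⟨ toℕ-⊕ a 𝟎 ⟩
  (toℕ a + 0) % suc m ≡⟨ cong (_% suc m) (+-identityʳ (toℕ a)) ⟩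
  toℕ a % suc m       ≡⟨ m<n⇒m%n≡m (toℕ<n a) ⟩
  toℕ a               ∎)
  where open ≡-Reasoning

%-absorbˡ-+ : ∀ x y d .{{_ : NonZero d}} → (x % d + y) % d ≡ (x + y) % d
%-absorbˡ-+ x y d = begin
  (x % d + y) % d         ≡⟨ %-distribˡ-+ (x % d) y d ⟩
  (x % d % d + y % d) % d ≡⟨ cong (λ z → (z + y % d) % d) (m%n%n≡m%n x d) ⟩
  (x % d + y % d) % d     ≡⟨ sym (%-distribˡ-+ x y d) ⟩
  (x + y) % d             ∎
  where open ≡-Reasoning

%-absorbʳ-+ : ∀ x y d .{{_ : NonZero d}} → (x + y % d) % d ≡ (x + y) % d
%-absorbʳ-+ x y d = begin
  (x + y % d) % d ≡⟨ cong (_% d) (+-comm x (y % d)) ⟩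
  (y % d + x) % d ≡⟨ %-absorbˡ-+ y x d ⟩
  (y + x) % d     ≡⟨ cong (_% d) (+-comm y x) ⟩
  (x + y) % d     ∎
  where open ≡-Reasoning

⊕-assoc : ∀ {m} (a b c : Sym m) → (a ⊕ b) ⊕ c ≡ a ⊕ (b ⊕ c)
⊕-assoc {m} a b c = toℕ-injective (begin
  toℕ ((a ⊕ b) ⊕ c)     ≡⟨ toℕ-⊕ (a ⊕ b) c ⟩
  (toℕ (a ⊕ b) + C) % d ≡⟨ cong (λ x → (x + C) % d) (toℕ-⊕ a b) ⟩
  ((A + B) % d + C) % d ≡⟨ %-absorbˡ-+ (A + B) C d ⟩
  (A + B + C) % d       ≡⟨ cong (_% d) (+-assoc A B C) ⟩
  (A + (B + C)) % d     ≡⟨ sym (%-absorbʳ-+ A (B + C) d) ⟩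
  (A + (B + C) % d) % d ≡⟨ cong (λ x → (A + x) % d) (sym (toℕ-⊕ b c)) ⟩
  (A + toℕ (b ⊕ c)) % d ≡⟨ sym (toℕ-⊕ a (b ⊕ c)) ⟩
  toℕ (a ⊕ (b ⊕ c))     ∎)
  where
    open ≡-Reasoning
    d = suc m
    A = toℕ a
    B = toℕ b
    C = toℕ c

!-shift-++ : ∀ {m} (u : Word m) (a : Sym m) (w : Word m) (i : Fin (length u))
  → (shift u a ++ w) ! toℕ i ≡ just (lookup u i ⊕ a)
!-shift-++ (x ∷ u) a w Fin.zero    = refl
!-shift-++ (x ∷ u) a w (Fin.suc i) = !-shift-++ u a w i

!-shift-skip : ∀ {m} (u : Word m) (a : Sym m) (w : Word m) t
  → (shift u a ++ w) ! (length u + t) ≡ w ! t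
!-shift-skip []      a w t = refl
!-shift-skip (x ∷ u) a w t = !-shift-skip u a w t

⊠-! : ∀ {m} (u v : Word m) (i : Fin (length u)) j {a : Sym m}
  → v ! j ≡ just a → (u ⊠ v) ! (j * length u + toℕ i) ≡ just (lookup u i ⊕ a)
⊠-! u (b ∷ v) i zero    refl = !-shift-++ u b (u ⊠ v) i
⊠-! u (b ∷ v) i (suc j) v!j  = begin
  (shift u b ++ (u ⊠ v)) ! (length u + j * length u + toℕ i)
    ≡⟨ cong ((shift u b ++ (u ⊠ v)) !_) (+-assoc (length u) (j * length u) (toℕ i)) ⟩
  (shift u b ++ (u ⊠ v)) ! (length u + (j * length u + toℕ i))
    ≡⟨ !-shift-skip u b (u ⊠ v) _ ⟩
  (u ⊠ v) ! (j * length u + toℕ i)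
    ≡⟨ ⊠-! u v i j v!j ⟩
  just (lookup u i ⊕ _) ∎
  where open ≡-Reasoning

-- σ is k-self-similar with digit offsets d : Fin k → Σ.  (A record, so
-- that k, d and σ can be recovered from a proof of it.)
record SelfSimilar {m} (k : ℕ) (d : Fin k → Sym m) (σ : ℕ → Sym m) : Set where
  constructor selfSimilar
  field recursion : ∀ (r : Fin k) j → σ (j * k + toℕ r) ≡ σ j ⊕ d r
open SelfSimilar

-- The Keane limit K(u) is |u|-self-similar with offsets u_i: both letters
-- j and j·|u| + i are stable from some N on, and u^{×(N+1)} = u × u^{×N}.
keaneLimit-selfSimilar : ∀ {m} (u : Word m) (σ : ℕ → Sym m)
  → IsKeaneLimit u σ → SelfSimilar (length u) (lookup u) σ
keaneLimit-selfSimilar u σ lim = selfSimilar blockLetter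
  where
    blockLetter : ∀ (i : Fin (length u)) j → σ (j * length u + toℕ i) ≡ σ j ⊕ lookup u i
    blockLetter i j with lim j | lim (j * length u + toℕ i)
    ... | N₁ , stable₁ | N₂ , stable₂ = trans (just-injective inProduct) (⊕-comm (lookup u i) (σ j))
      where
        N = N₁ + N₂
        inProduct : just (σ (j * length u + toℕ i)) ≡ just (lookup u i ⊕ σ j)
        inProduct = trans (sym (stable₂ (suc N) (≤-trans (m≤n+m N₂ N₁) (n≤1+n N))))
                          (⊠-! u (kpow u N) i j (stable₁ N (m≤m+n N₁ N₂)))

selfSimilar-progression : ∀ {m} {k} {d : Fin k → Sym m} {σ : ℕ → Sym m}
  → SelfSimilar k d σ → (r : Fin k) → subseq σ (toℕ r) k ∼ σ
selfSimilar-progression {k = k} {σ = σ} selfSim r = _ , λ j →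
  trans (cong σ (trans (+-comm (toℕ r) (k * j)) (cong (_+ toℕ r) (*-comm k j))))
        (recursion selfSim r j)

selfSimilar-refine : ∀ {m} {k} {d : Fin k → Sym m} {σ : ℕ → Sym m}
  → SelfSimilar k d σ → ∀ {q K} (r : Fin k)
  → subseq σ q K ∼ σ → subseq σ (toℕ r + q * k) (k * K) ∼ σ
selfSimilar-refine {k = k} {d} {σ} selfSim {q} {K} r (c , σ-qK) = c ⊕ d r , λ j → begin
  σ (toℕ r + q * k + k * K * j)  ≡⟨ cong σ (regroup (toℕ r) q k K j) ⟩
  σ ((q + K * j) * k + toℕ r)    ≡⟨ recursion selfSim r (q + K * j) ⟩
  σ (q + K * j) ⊕ d r            ≡⟨ cong (_⊕ d r) (σ-qK j) ⟩
  (σ j ⊕ c) ⊕ d r                ≡⟨ ⊕-assoc (σ j) c (d r) ⟩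
  σ j ⊕ (c ⊕ d r)                ∎
  where
    open ≡-Reasoning
    open +-*-Solver
    regroup : ∀ r q k K j → r + q * k + k * K * j ≡ (q + K * j) * k + r
    regroup = solve 5 (λ r q k K j → r :+ q :* k :+ k :* K :* j := (q :+ K :* j) :* k :+ r) refl

selfSimilar-powers : ∀ {m} {k} .{{_ : NonZero k}} {d : Fin k → Sym m} {σ : ℕ → Sym m}
  → SelfSimilar k d σ → ∀ n i → i < k ^ n → subseq σ i (k ^ n) ∼ σ
selfSimilar-powers {σ = σ} selfSim zero .0 (s≤s z≤n) =
  𝟎 , λ j → trans (cong σ (+-identityʳ j)) (sym (⊕-identityʳ (σ j)))
selfSimilar-powers {k = k} {σ = σ} selfSim (suc n) i i<kᵏ⁺¹ =
  subst (λ a → subseq σ a (k ^ suc n) ∼ σ) (sym property)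
        (selfSimilar-refine selfSim remainder (selfSimilar-powers selfSim n quotient q<kⁿ))
  where
    open DivMod (i divMod k) using (quotient; remainder; property)
    q<kⁿ : quotient < k ^ n
    q<kⁿ = m<n*o⇒m/o<n (subst (i <_) (*-comm k (k ^ n)) i<kᵏ⁺¹)

mainTheorem18 : ∀ {m : ℕ} (u : Word m) (σ : ℕ → Sym m)
    → head u ≡ just 𝟎
    → 2 ≤ length u
    → IsKeaneLimit u σ
    → ((i : Fin (length u))
        → (∀ n → σ (n * length u + toℕ i) ≡ σ n ⊕ lookup u i)
          × (subseq σ (toℕ i) (length u) ∼ σ))
      × (∀ n i → i < length u ^ n → InAS σ i (length u ^ n))
mainTheorem18 u σ _ 2≤k lim =
  (λ i → recursion selfSim i , selfSimilar-progression selfSim i) ,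
  (λ n i i<kⁿ → m^n>0 (length u) n , selfSimilar-powers selfSim n i i<kⁿ)
  where
    instance
      k≢0 : NonZero (length u)
      k≢0 = >-nonZero (≤-trans (s≤s z≤n) 2≤k)
    selfSim : SelfSimilar (length u) (lookup u) σ
    selfSim = keaneLimit-selfSimilar u σ lim
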